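{- For every $n\ge0$, the number of restricted ascent sequences of length $n$ equals the $n$-th Catalan number $C_n=\frac{1}{n+1}\binom{2n}{n}$.
   Context: A sequence $(x_1,\dots,x_n)$ of nonnegative integers is a restricted ascent sequence of length $n$ if $x_1=0$ and, for all $2\le i\le n$, $m-1\le x_i\le 1+\mathrm{asc}(x_1,\dots,x_{i-1})$, where $m=\max(x_1,\dots,x_{i-1})$ and $\mathrm{asc}(y_1,\dots,y_k)=|\{1\le j<k: y_j<y_{j+1}\}|$. The empty sequence is the unique restricted ascent sequence of length $0$. -}

module Defs where

open import Data.Nat using (ℕ; zero; suc; _+_; _*_; _∸_; _≤_; _<_; _<?_; _⊔_; _/_)
open import Relation.Nullary using (yes; no)
open import Relation.Binary.PropositionalEquality using (_≡_)
open import Data.Nat.Combinatorics using (_C_)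
open import Data.List using (List; []; _∷_; length; _∷ʳ_)
open import Data.List.Membership.Propositional using (_∈_)
open import Data.List.Relation.Unary.Unique.Propositional using (Unique)
open import Data.Product using (Σ; _×_)
open import Function.Bundles using (_⇔_)

-- maximum of a (nonempty) list; max of [] is 0 (only used on nonempty prefixes)
maxL : List ℕ → ℕ
maxL [] = 0
maxL (x ∷ xs) = x ⊔ maxL xs

ascFrom : ℕ → List ℕ → ℕ
ascFrom x [] = 0
ascFrom x (y ∷ ys) with x <? y
... | yes _ = suc (ascFrom y ys)
... | no _  = ascFrom y ys

asc : List ℕ → ℕ
asc [] = 0
asc (x ∷ xs) = ascFrom x xs

-- Restricted ascent sequences, built by appending at the end (snoc):
-- the empty sequence; the sequence (0); and xs ∷ʳ x for nonempty RAS xs with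
-- max(xs) - 1 ≤ x ≤ 1 + asc(xs)  (natural subtraction; x ≥ 0 anyway).
data RAS : List ℕ → Set where
  ras-nil  : RAS []
  ras-one  : RAS (0 ∷ [])
  ras-snoc : ∀ {y ys} x → RAS (y ∷ ys) →
             maxL (y ∷ ys) ∸ 1 ≤ x → x ≤ suc (asc (y ∷ ys)) →
             RAS ((y ∷ ys) ∷ʳ x)

catalan : ℕ → ℕ
catalan n = ((2 * n) C n) / suc n

-- "the number of restricted ascent sequences of length n is k":
-- there is a duplicate-free list enumerating exactly them, of length k.
NumRAS : ℕ → ℕ → Set
NumRAS n k = Σ (List (List ℕ)) λ L →
  Unique L × length L ≡ k × (∀ xs → (xs ∈ L) ⇔ (RAS xs × length xs ≡ n))

-- Whether x may be appended to a restricted ascent sequence, and the maximum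
-- and ascent number of the result, depend only on x and on the last entry,
-- maximum and ascent number of the sequence.  As the last entry is always the
-- maximum or one below it, these data form a shape: flat (all entries 0),
-- peak m d (last = max = m+1) or dip m d (last = m, max = m+1), with
-- asc = m+1+d in both cases.  So the sequences of length n+1 are enumerated
-- layer by layer along shape transitions, and their number is the number of
-- n-step completions of the shape of (0).  With τ f h = f h − f (h+1) + f (h+2),
-- the completion counts of peak m d and dip m d are τ^d (ballot k) 1 and
-- τ^(d+1) (ballot k) 0 for the ballot numbers
-- ballot k h = C(2k+h+1, k) − C(2k+h+1, k+h+2), because τ commutes with the
-- partial-sum recursion defining them; the flat shape gets ballot n 0 = C_(n+1).
module Submission where

open import Defs
open import Data.Nat using (ℕ; zero; suc)
open import Data.List using ([]; _∷_; map; length)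
open import Data.List.Properties using (length-map)
open import Data.List.Membership.Propositional using (_∈_)
open import Data.List.Relation.Unary.Any using (here)
open import Data.List.Relation.Unary.AllPairs using ([]; _∷_)
open import Data.List.Relation.Unary.All using ([])
open import Data.Product using (_×_; _,_; proj₁)
open import Function.Bundles using (_⇔_; mk⇔)
open import Relation.Binary.PropositionalEquality using (_≡_; refl; trans)

module BallotNumbers where

  open import Data.Nat
  open import Data.Nat.Properties
  open import Data.Nat.Combinatorics using (_C_; nC1≡n; nCk≡nC[n∸k]; nCk+nC[k+1]≡[n+1]C[k+1]; k>n⇒nCk≡0)
  open import Data.Nat.DivMod using (m*n/n≡m)
  open import Data.Nat.Tactic.RingSolver using (solve-∀)
  open import Relation.Binary.PropositionalEquality

  [k+1]*[n+1]C[k+1]≡[n+1]*nCk : ∀ n k → suc k * (suc n C suc k) ≡ suc n * (n C k)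
  [k+1]*[n+1]C[k+1]≡[n+1]*nCk zero zero = refl
  [k+1]*[n+1]C[k+1]≡[n+1]*nCk zero (suc k) = *-zeroʳ (suc (suc k))
  [k+1]*[n+1]C[k+1]≡[n+1]*nCk (suc n) zero =
    trans (*-identityˡ _) (trans (nC1≡n (suc (suc n))) (sym (*-identityʳ (suc (suc n)))))
  [k+1]*[n+1]C[k+1]≡[n+1]*nCk (suc n) (suc k) = begin
    suc (suc k) * (suc (suc n) C suc (suc k))
      ≡⟨ cong (suc (suc k) *_) (nCk+nC[k+1]≡[n+1]C[k+1] (suc n) (suc k)) ⟨
    suc (suc k) * (a + b)
      ≡⟨ split (suc k) a b ⟩
    a + (suc k * a + suc (suc k) * b)
      ≡⟨ cong (a +_) (cong₂ _+_ ([k+1]*[n+1]C[k+1]≡[n+1]*nCk n k) ([k+1]*[n+1]C[k+1]≡[n+1]*nCk n (suc k))) ⟩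
    a + (suc n * (n C k) + suc n * (n C suc k))
      ≡⟨ cong (a +_) (*-distribˡ-+ (suc n) (n C k) _) ⟨
    a + suc n * (n C k + n C suc k)
      ≡⟨ cong (λ z → a + suc n * z) (nCk+nC[k+1]≡[n+1]C[k+1] n k) ⟩
    suc (suc n) * a
      ∎
    where
    open ≡-Reasoning
    a = suc n C suc k
    b = suc n C suc (suc k)
    split : ∀ j x y → suc j * (x + y) ≡ x + (j * x + suc j * y)
    split = solve-∀

  ballot : ℕ → ℕ → ℕ
  ballot zero h = 1
  ballot (suc k) zero = ballot k 0 + ballot k 1
  ballot (suc k) (suc h) = ballot (suc k) h + ballot k (suc (suc h))

  -- t and j are abstracted so that recursive calls can be made at index terms
  -- matching Pascal's rule syntactically.
  ballot+C≡C : ∀ k h {t j} → suc (k + k + h) ≡ t → h + k ≡ j →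
               ballot k h + t C suc (suc j) ≡ t C k
  ballot+C≡C zero h refl refl = cong suc (k>n⇒nCk≡0 (s≤s (s≤s (m≤m+n h 0))))
  ballot+C≡C (suc k) zero refl refl = begin
    (ballot k 0 + ballot k 1) + suc (suc m) C (3 + k)
      ≡⟨ cong ((ballot k 0 + ballot k 1) +_) (pascal₂ (suc k)) ⟨
    (ballot k 0 + ballot k 1) + ((m C suc k + m C (2 + k)) + suc m C (3 + k))
      ≡⟨ regroup (ballot k 0) (ballot k 1) (m C suc k) (m C (2 + k)) (suc m C (3 + k)) ⟩
    (ballot k 0 + m C (2 + k)) + (ballot k 1 + suc m C (3 + k)) + m C suc k
      ≡⟨ cong₂ (λ x y → x + y + m C suc k) (ballot+C≡C k 0 (cong (_+ 0) (sym (+-suc k k))) refl)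
                                           (ballot+C≡C k 1 (cong suc (odd-index k)) refl) ⟩
    m C k + suc m C k + m C suc k
      ≡⟨ swap (m C k) (suc m C k) (m C suc k) ⟩
    suc m C k + (m C k + m C suc k)
      ≡⟨ cong (suc m C k +_) (nCk+nC[k+1]≡[n+1]C[k+1] m k) ⟩
    suc m C k + suc m C suc k
      ≡⟨ nCk+nC[k+1]≡[n+1]C[k+1] (suc m) k ⟩
    suc (suc m) C suc k
      ∎
    where
    open ≡-Reasoning
    m = k + suc k + 0
    pascal₂ : ∀ i → (m C i + m C suc i) + suc m C suc (suc i) ≡ suc (suc m) C suc (suc i)
    pascal₂ i = trans (cong (_+ suc m C suc (suc i)) (nCk+nC[k+1]≡[n+1]C[k+1] m i))
                      (nCk+nC[k+1]≡[n+1]C[k+1] (suc m) (suc i))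
    regroup : ∀ a b x y z → (a + b) + ((x + y) + z) ≡ (a + y) + (b + z) + x
    regroup = solve-∀
    odd-index : ∀ k → k + k + 1 ≡ k + suc k + 0
    odd-index = solve-∀
    swap : ∀ a b c → a + b + c ≡ b + (a + c)
    swap = solve-∀
  ballot+C≡C (suc k) (suc h) refl refl = begin
    (ballot (suc k) h + ballot k (2 + h)) + suc (suc m) C suc i
      ≡⟨ cong ((ballot (suc k) h + ballot k (2 + h)) +_) (nCk+nC[k+1]≡[n+1]C[k+1] (suc m) i) ⟨
    (ballot (suc k) h + ballot k (2 + h)) + (suc m C i + suc m C suc i)
      ≡⟨ interchange (ballot (suc k) h) (ballot k (2 + h)) (suc m C i) (suc m C suc i) ⟩
    (ballot (suc k) h + suc m C i) + (ballot k (2 + h) + suc m C suc i)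
      ≡⟨ cong₂ _+_ (ballot+C≡C (suc k) h (cong suc (sym (+-suc (k + suc k) h))) refl)
                   (ballot+C≡C k (2 + h) (cong suc (even-index k h)) (cong suc (sym (+-suc h k)))) ⟩
    suc m C suc k + suc m C k
      ≡⟨ +-comm (suc m C suc k) (suc m C k) ⟩
    suc m C k + suc m C suc k
      ≡⟨ nCk+nC[k+1]≡[n+1]C[k+1] (suc m) k ⟩
    suc (suc m) C suc k
      ∎
    where
    open ≡-Reasoning
    m = k + suc k + suc h
    i = suc (suc (h + suc k))
    even-index : ∀ k h → k + k + suc (suc h) ≡ k + suc k + suc h
    even-index = solve-∀
    interchange : ∀ a b x y → (a + b) + (x + y) ≡ (a + x) + (b + y)
    interchange = solve-∀


  -- ballot k 0 = X − Y with X = C(2k+1,k) = C(2k+1,k+1) and Y = C(2k+1,k+2);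
  -- absorption gives (k+2)(X+Y) = (2k+2)X, so (k+2)(X − Y) = 2X = C(2k+2,k+1).
  ballot≡catalan : ∀ k → ballot k 0 ≡ catalan (suc k)
  ballot≡catalan k = begin
    ballot k 0
      ≡⟨ m*n/n≡m (ballot k 0) (2 + k) ⟨
    ballot k 0 * (2 + k) / (2 + k)
      ≡⟨ cong (_/ (2 + k)) (cancel-ballot (ballot+C≡C k 0 (trans (cong suc (+-identityʳ (k + k))) (sym (+-suc k k))) refl)
                                           absorb) ⟩
    (n C k + n C k) / (2 + k)
      ≡⟨ cong (λ x → (n C k + x) / (2 + k)) symmetric ⟩
    (n C k + n C suc k) / (2 + k)
      ≡⟨ cong (_/ (2 + k)) (nCk+nC[k+1]≡[n+1]C[k+1] n k) ⟩
    (suc n C suc k) / (2 + k)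
      ≡⟨ cong (λ m → (m C suc k) / (2 + k)) (double-suc k) ⟩
    catalan (suc k)
      ∎
    where
    open ≡-Reasoning
    n = k + suc k
    symmetric : n C k ≡ n C suc k
    symmetric = trans (nCk≡nC[n∸k] (m≤m+n k (suc k))) (cong (n C_) (m+n∸m≡n k (suc k)))
    absorb : (2 + k) * (n C k + n C (2 + k)) ≡ suc n * (n C k)
    absorb = begin
      (2 + k) * (n C k + n C (2 + k))
        ≡⟨ cong (λ x → (2 + k) * (x + n C (2 + k))) symmetric ⟩
      (2 + k) * (n C suc k + n C (2 + k))
        ≡⟨ cong ((2 + k) *_) (nCk+nC[k+1]≡[n+1]C[k+1] n (suc k)) ⟩
      (2 + k) * (suc n C (2 + k))
        ≡⟨ [k+1]*[n+1]C[k+1]≡[n+1]*nCk n (suc k) ⟩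
      suc n * (n C suc k)
        ≡⟨ cong (suc n *_) symmetric ⟨
      suc n * (n C k)
        ∎
    double-suc : ∀ k → suc (k + suc k) ≡ 2 * suc k
    double-suc = solve-∀
    cancel-ballot : ∀ {b x y} → b + y ≡ x → (2 + k) * (x + y) ≡ suc (k + suc k) * x → b * (2 + k) ≡ x + x
    cancel-ballot {b} {x} {y} b+y≡x e = +-cancelʳ-≡ (suc (k + suc k) * x) _ _ (begin
      b * (2 + k) + suc (k + suc k) * x
        ≡⟨ cong (b * (2 + k) +_) e ⟨
      b * (2 + k) + (2 + k) * (x + y)
        ≡⟨ regroup k b x y ⟩
      (2 + k) * (b + y) + (2 + k) * x
        ≡⟨ cong (λ z → (2 + k) * z + (2 + k) * x) b+y≡x ⟩
      (2 + k) * x + (2 + k) * x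
        ≡⟨ split k x ⟩
      (x + x) + suc (k + suc k) * x
        ∎)
      where
      regroup : ∀ k b x y → b * (2 + k) + (2 + k) * (x + y) ≡ (2 + k) * (b + y) + (2 + k) * x
      regroup = solve-∀
      split : ∀ k x → (2 + k) * x + (2 + k) * x ≡ (x + x) + suc (k + suc k) * x
      split = solve-∀

module TrinomialTransform where

  open import Data.Nat using (ℕ; zero; suc)
  open import Data.Integer using (ℤ; +_; _+_; _-_)
  import Data.Integer.Properties as ℤ
  open import Data.Integer.Tactic.RingSolver using (solve-∀)
  open import Relation.Binary.PropositionalEquality

  tri : (ℕ → ℤ) → ℕ → ℤ
  tri f h = f h - f (suc h) + f (suc (suc h))

  tri^ : ℕ → (ℕ → ℤ) → ℕ → ℤ
  tri^ zero f = f
  tri^ (suc e) f = tri (tri^ e f)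

  sumBelow : (ℕ → ℤ) → ℕ → ℤ
  sumBelow f zero = + 0
  sumBelow f (suc r) = f r + sumBelow f r

  tri^-const : ∀ e c h → tri^ e (λ _ → c) h ≡ c
  tri^-const zero c h = refl
  tri^-const (suc e) c h
    rewrite tri^-const e c h | tri^-const e c (suc h) | tri^-const e c (suc (suc h)) = cancel c
    where
    cancel : ∀ c → c - c + c ≡ c
    cancel = solve-∀

  tri^-shift : ∀ {f g : ℕ → ℤ} → (∀ h → f (suc h) ≡ f h + g (suc (suc h))) →
               ∀ e h → tri^ e f (suc h) ≡ tri^ e f h + tri^ e g (suc (suc h))
  tri^-shift f≡f+g zero h = f≡f+g h
  tri^-shift {f} {g} f≡f+g (suc e) h =
    step {tri^ e f h} {b₂ = tri^ e g (suc (suc h))} (shift h) (shift (suc h)) (shift (suc (suc h)))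
    where
    shift : ∀ h → tri^ e f (suc h) ≡ tri^ e f h + tri^ e g (suc (suc h))
    shift = tri^-shift f≡f+g e
    step : ∀ {a₀ a₁ a₂ a₃ b₂ b₃ b₄ : ℤ} → a₁ ≡ a₀ + b₂ → a₂ ≡ a₁ + b₃ → a₃ ≡ a₂ + b₄ →
           a₁ - a₂ + a₃ ≡ (a₀ - a₁ + a₂) + (b₂ - b₃ + b₄)
    step {a₀} {b₂ = b₂} {b₃} {b₄} refl refl refl = identity a₀ b₂ b₃ b₄
      where
      identity : ∀ a b₂ b₃ b₄ → (a + b₂) - (a + b₂ + b₃) + (a + b₂ + b₃ + b₄)
                                ≡ (a - (a + b₂) + (a + b₂ + b₃)) + (b₂ - b₃ + b₄)
      identity = solve-∀

  tri^-origin : ∀ {f g : ℕ → ℤ} → f 0 ≡ g 0 + g 1 → (∀ h → f (suc h) ≡ f h + g (suc (suc h))) →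
                ∀ e → tri^ e f 0 ≡ tri^ e g 0 + sumBelow (λ r → tri^ r g 1) (suc e)
  tri^-origin {g = g} f₀ f≡f+g zero = trans f₀ (cong (λ z → g 0 + z) (sym (ℤ.+-identityʳ (g 1))))
  tri^-origin {f} {g} f₀ f≡f+g (suc e) =
    step (tri^-origin f₀ f≡f+g e) (tri^-shift {f} {g} f≡f+g e 0) (tri^-shift {f} {g} f≡f+g e 1)
    where
    G : ℕ → ℤ
    G = tri^ e g
    step : ∀ {a₀ a₁ a₂ s : ℤ} → a₀ ≡ G 0 + s → a₁ ≡ a₀ + G 2 → a₂ ≡ a₁ + G 3 →
           a₀ - a₁ + a₂ ≡ (G 0 - G 1 + G 2) + ((G 1 - G 2 + G 3) + s)
    step {s = s} refl refl refl = identity (G 0) s (G 1) (G 2) (G 3)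
      where
      identity : ∀ v₀ s v₁ v₂ v₃ → (v₀ + s) - (v₀ + s + v₂) + (v₀ + s + v₂ + v₃)
                                   ≡ (v₀ - v₁ + v₂) + ((v₁ - v₂ + v₃) + s)
      identity = solve-∀

module Completions where

  open import Data.Nat as ℕ using (ℕ; zero; suc)
  import Data.Nat.Properties as ℕₚ
  open import Data.Nat.ListAction using (sum)
  open import Data.Integer using (ℤ; +_; _+_; _-_)
  open import Data.Integer.Properties using (pos-+; +-injective)
  open import Data.Integer.Tactic.RingSolver using (solve-∀)
  open import Data.List using (List; []; _∷_; map)
  open import Data.Product using (_×_; _,_; proj₂)
  open import Function using (_∘_)
  open import Relation.Binary.PropositionalEquality
  open BallotNumbers
  open TrinomialTransform

  data Shape : Set where
    flat : Shape
    peak dip : ℕ → ℕ → Shape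

  ascents : ℕ → ℕ → List (ℕ × Shape)
  ascents x zero = []
  ascents x (suc r) = (suc x , peak x r) ∷ ascents (suc x) r

  movesFrom : ℕ → ℕ → Shape → List (ℕ × Shape)
  movesFrom m d σ = (m , dip m d) ∷ (suc m , σ) ∷ ascents (suc m) (suc d)

  moves : Shape → List (ℕ × Shape)
  moves flat = (0 , flat) ∷ (1 , peak 0 0) ∷ []
  moves (peak m d) = movesFrom m d (peak m d)
  moves (dip m d) = movesFrom m d (peak m (suc d))

  completions : ℕ → Shape → ℕ
  completions zero σ = 1
  completions (suc k) σ = sum (map (completions k ∘ proj₂) (moves σ))

  ballotℤ : ℕ → ℕ → ℤ
  ballotℤ k h = + ballot k h

  ballotℤ-origin : ∀ k → ballotℤ (suc k) 0 ≡ ballotℤ k 0 + ballotℤ k 1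
  ballotℤ-origin k = pos-+ (ballot k 0) (ballot k 1)

  ballotℤ-shift : ∀ k h → ballotℤ (suc k) (suc h) ≡ ballotℤ (suc k) h + ballotℤ k (suc (suc h))
  ballotℤ-shift k h = pos-+ (ballot (suc k) h) (ballot k (suc (suc h)))

  +-sum₃ : ∀ a b c → + (a ℕ.+ (b ℕ.+ c)) ≡ + a + (+ b + + c)
  +-sum₃ a b c = trans (pos-+ a (b ℕ.+ c)) (cong (λ z → + a + z) (pos-+ b c))

  peak≡tri^ : ∀ k m d → + completions k (peak m d) ≡ tri^ d (ballotℤ k) 1
  dip≡tri^ : ∀ k m d → + completions k (dip m d) ≡ tri^ (suc d) (ballotℤ k) 0
  ascents≡sumBelow : ∀ k x r → + sum (map (completions k ∘ proj₂) (ascents x r))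
                               ≡ sumBelow (λ s → tri^ s (ballotℤ k) 1) r

  peak≡tri^ zero m d = sym (tri^-const d (+ 1) 1)
  peak≡tri^ (suc k) m d = begin
    + (completions k (dip m d) ℕ.+ (completions k (peak m d) ℕ.+ rest))
      ≡⟨ +-sum₃ (completions k (dip m d)) (completions k (peak m d)) rest ⟩
    + completions k (dip m d) + (+ completions k (peak m d) + + rest)
      ≡⟨ cong₂ _+_ (dip≡tri^ k m d) (cong₂ _+_ (peak≡tri^ k m d) (ascents≡sumBelow k (suc m) (suc d))) ⟩
    (T 0 - T 1 + T 2) + (T 1 + S)
      ≡⟨ regroup (T 0) (T 1) (T 2) S ⟩
    (T 0 + S) + T 2
      ≡⟨ cong (_+ T 2) (tri^-origin (ballotℤ-origin k) (ballotℤ-shift k) d) ⟨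
    tri^ d (ballotℤ (suc k)) 0 + T 2
      ≡⟨ tri^-shift (ballotℤ-shift k) d 0 ⟨
    tri^ d (ballotℤ (suc k)) 1
      ∎
    where
    open ≡-Reasoning
    rest = sum (map (completions k ∘ proj₂) (ascents (suc m) (suc d)))
    T = tri^ d (ballotℤ k)
    S = sumBelow (λ s → tri^ s (ballotℤ k) 1) (suc d)
    regroup : ∀ a b c s → (a - b + c) + (b + s) ≡ (a + s) + c
    regroup = solve-∀
  dip≡tri^ zero m d = sym (tri^-const (suc d) (+ 1) 0)
  dip≡tri^ (suc k) m d = begin
    + (completions k (dip m d) ℕ.+ (completions k (peak m (suc d)) ℕ.+ rest))
      ≡⟨ +-sum₃ (completions k (dip m d)) (completions k (peak m (suc d))) rest ⟩
    + completions k (dip m d) + (+ completions k (peak m (suc d)) + + rest)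
      ≡⟨ cong₂ _+_ (dip≡tri^ k m d) (cong₂ _+_ (peak≡tri^ k m (suc d)) (ascents≡sumBelow k (suc m) (suc d))) ⟩
    tri^ (suc d) (ballotℤ k) 0 + sumBelow (λ s → tri^ s (ballotℤ k) 1) (suc (suc d))
      ≡⟨ tri^-origin (ballotℤ-origin k) (ballotℤ-shift k) (suc d) ⟨
    tri^ (suc d) (ballotℤ (suc k)) 0
      ∎
    where
    open ≡-Reasoning
    rest = sum (map (completions k ∘ proj₂) (ascents (suc m) (suc d)))
  ascents≡sumBelow k x zero = refl
  ascents≡sumBelow k x (suc r) =
    trans (pos-+ (completions k (peak x r)) _) (cong₂ _+_ (peak≡tri^ k x r) (ascents≡sumBelow k (suc x) r))

  flat≡ballot : ∀ k → completions k flat ≡ ballot k 0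
  flat≡ballot zero = refl
  flat≡ballot (suc k) = cong₂ ℕ._+_ (flat≡ballot k) (trans (ℕₚ.+-identityʳ _) (+-injective (peak≡tri^ k 0 0)))

module SequenceShapes where

  open import Data.Nat
  open import Data.Nat.Properties
  open import Data.List using (List; []; _∷_; _∷ʳ_)
  open import Data.List.Membership.Propositional using (_∈_)
  open import Data.List.Relation.Unary.Any using (here; there)
  open import Data.Product using (Σ; _×_; _,_)
  open import Data.Sum using (inj₁; inj₂)
  open import Data.Empty using (⊥-elim)
  open import Relation.Nullary using (yes; no)
  open import Relation.Binary.PropositionalEquality
  open Completions

  lastEntry : List ℕ → ℕ
  lastEntry [] = 0
  lastEntry (x ∷ []) = x
  lastEntry (x ∷ y ∷ ys) = lastEntry (y ∷ ys)

  lastEntry-∷ʳ : ∀ xs x → lastEntry (xs ∷ʳ x) ≡ x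
  lastEntry-∷ʳ [] x = refl
  lastEntry-∷ʳ (y ∷ []) x = refl
  lastEntry-∷ʳ (y ∷ z ∷ zs) x = lastEntry-∷ʳ (z ∷ zs) x

  maxL-∷ʳ : ∀ xs x → maxL (xs ∷ʳ x) ≡ maxL xs ⊔ x
  maxL-∷ʳ [] x = ⊔-comm x 0
  maxL-∷ʳ (y ∷ ys) x = trans (cong (y ⊔_) (maxL-∷ʳ ys x)) (sym (⊔-assoc y (maxL ys) x))

  ascFrom-∷ʳ-< : ∀ y ys x → lastEntry (y ∷ ys) < x → ascFrom y (ys ∷ʳ x) ≡ suc (ascFrom y ys)
  ascFrom-∷ʳ-< y [] x lt with y <? x
  ... | yes _ = refl
  ... | no ¬lt = ⊥-elim (¬lt lt)
  ascFrom-∷ʳ-< y (z ∷ zs) x lt with y <? z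
  ... | yes _ = cong suc (ascFrom-∷ʳ-< z zs x lt)
  ... | no _ = ascFrom-∷ʳ-< z zs x lt

  ascFrom-∷ʳ-≤ : ∀ y ys x → x ≤ lastEntry (y ∷ ys) → ascFrom y (ys ∷ʳ x) ≡ ascFrom y ys
  ascFrom-∷ʳ-≤ y [] x le with y <? x
  ... | yes lt = ⊥-elim (<⇒≱ lt le)
  ... | no _ = refl
  ascFrom-∷ʳ-≤ y (z ∷ zs) x le with y <? z
  ... | yes _ = cong suc (ascFrom-∷ʳ-≤ z zs x le)
  ... | no _ = ascFrom-∷ʳ-≤ z zs x le

  HasShape : List ℕ → Shape → Set
  HasShape xs flat = lastEntry xs ≡ 0 × maxL xs ≡ 0 × asc xs ≡ 0
  HasShape xs (peak m d) = lastEntry xs ≡ suc m × maxL xs ≡ suc m × asc xs ≡ suc m + d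
  HasShape xs (dip m d) = lastEntry xs ≡ m × maxL xs ≡ suc m × asc xs ≡ suc m + d

  Admissible : List ℕ → ℕ → Set
  Admissible xs x = maxL xs ∸ 1 ≤ x × x ≤ suc (asc xs)

  ∈-ascents⁻ : ∀ {a r x σ} → (x , σ) ∈ ascents a r →
               Σ ℕ λ z → Σ ℕ λ s → x ≡ suc z × σ ≡ peak z s × a ≤ z × suc (z + s) ≡ a + r
  ∈-ascents⁻ {a} {suc r} (here refl) = a , r , refl , refl , ≤-refl , sym (+-suc a r)
  ∈-ascents⁻ {a} {suc r} (there mem) with ∈-ascents⁻ mem
  ... | z , s , refl , refl , a<z , e = z , s , refl , refl , <⇒≤ a<z , trans e (sym (+-suc a r))

  ∈-ascents⁺ : ∀ {a r z} → a ≤ z → z < a + r → Σ Shape λ σ → (suc z , σ) ∈ ascents a r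
  ∈-ascents⁺ {a} {zero} {z} a≤z z<a+0 = ⊥-elim (≤⇒≯ a≤z (subst (z <_) (+-identityʳ a) z<a+0))
  ∈-ascents⁺ {a} {suc r} {z} a≤z z<a+r with m≤n⇒m<n∨m≡n a≤z
  ... | inj₂ refl = peak a r , here refl
  ... | inj₁ a<z with σ , mem ← ∈-ascents⁺ a<z (subst (z <_) (+-suc a r) z<a+r) = σ , there mem

  ∈-movesFrom⁺ : ∀ {m d x} σ → m ≤ x → x ≤ suc (suc m + d) → Σ Shape λ σ′ → (x , σ′) ∈ movesFrom m d σ
  ∈-movesFrom⁺ {m} {d} σ m≤x x≤top with m≤n⇒m<n∨m≡n m≤x
  ... | inj₂ refl = dip m d , here refl
  ... | inj₁ m<x with m≤n⇒m<n∨m≡n m<x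
  ... | inj₂ refl = σ , there (here refl)
  ∈-movesFrom⁺ {m} {d} {suc z} σ _ (s≤s z≤top) | inj₁ _ | inj₁ (s≤s m<z)
    with σ , mem ← ∈-ascents⁺ m<z (subst (z <_) (sym (+-suc (suc m) d)) (s≤s z≤top)) = σ , there (there mem)

  moves-complete : ∀ {xs σ x} → HasShape xs σ → Admissible xs x → Σ Shape λ σ′ → (x , σ′) ∈ moves σ
  moves-complete {σ = flat} {zero} _ _ = flat , here refl
  moves-complete {σ = flat} {suc zero} _ _ = peak 0 0 , there (here refl)
  moves-complete {σ = flat} {suc (suc x)} (_ , _ , asc≡) (_ , x≤asc) with s≤s () ← subst (λ a → suc (suc x) ≤ suc a) asc≡ x≤asc
  moves-complete {σ = peak m d} (_ , max≡ , asc≡) (lo , hi) =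
    ∈-movesFrom⁺ (peak m d) (subst (λ M → M ∸ 1 ≤ _) max≡ lo) (subst (λ a → _ ≤ suc a) asc≡ hi)
  moves-complete {σ = dip m d} (_ , max≡ , asc≡) (lo , hi) =
    ∈-movesFrom⁺ (peak m (suc d)) (subst (λ M → M ∸ 1 ≤ _) max≡ lo) (subst (λ a → _ ≤ suc a) asc≡ hi)

  m≤2+m+d : ∀ m d → m ≤ suc (suc m + d)
  m≤2+m+d m d = m≤n⇒m≤1+n (≤-trans (n≤1+n m) (m≤m+n (suc m) d))

  module _ (y : ℕ) (ys : List ℕ) where

    private
      xs = y ∷ ys

    -- The conclusion is HasShape (xs ∷ʳ x) σ for every σ whose last entry,
    -- maximum and ascent number are x, M and A.
    ∷ʳ-level : ∀ {x M A} → x ≤ lastEntry xs → maxL xs ≡ M → asc xs ≡ A →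
               x ≤ M → M ∸ 1 ≤ x → x ≤ suc A →
               (lastEntry (xs ∷ʳ x) ≡ x × maxL (xs ∷ʳ x) ≡ M × asc (xs ∷ʳ x) ≡ A) × Admissible xs x
    ∷ʳ-level {x} x≤last refl refl x≤max lo hi =
      (lastEntry-∷ʳ xs x , trans (maxL-∷ʳ xs x) (m≥n⇒m⊔n≡m x≤max) , ascFrom-∷ʳ-≤ y ys x x≤last) , lo , hi

    ∷ʳ-peak : ∀ {z s} → lastEntry xs < suc z → maxL xs ≤ suc z → suc (asc xs) ≡ suc z + s →
              HasShape (xs ∷ʳ suc z) (peak z s) × Admissible xs (suc z)
    ∷ʳ-peak {z} {s} last<x max≤x e =
      (lastEntry-∷ʳ xs (suc z) , trans (maxL-∷ʳ xs (suc z)) (m≤n⇒m⊔n≡n max≤x) ,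
       trans (ascFrom-∷ʳ-< y ys (suc z) last<x) e) ,
      ≤-trans (m∸n≤m (maxL xs) 1) max≤x ,
      s≤s (subst (z ≤_) (sym (suc-injective e)) (m≤m+n z s))

    ∷ʳ-ascent : ∀ {m d x σ} → lastEntry xs ≤ suc m → maxL xs ≡ suc m → asc xs ≡ suc m + d →
                (x , σ) ∈ ascents (suc m) (suc d) → HasShape (xs ∷ʳ x) σ × Admissible xs x
    ∷ʳ-ascent {m} {d} last≤ max≡ asc≡ mem with ∈-ascents⁻ mem
    ... | z , s , refl , refl , m<z , e =
      ∷ʳ-peak (s≤s (≤-trans last≤ m<z)) (subst (_≤ suc z) (sym max≡) (m≤n⇒m≤1+n m<z))
              (trans (cong suc asc≡) (sym (trans e (+-suc (suc m) d))))

    moves-sound : ∀ {σ x σ′} → HasShape xs σ → (x , σ′) ∈ moves σ →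
                  HasShape (xs ∷ʳ x) σ′ × Admissible xs x
    moves-sound {flat} (last≡ , max≡ , asc≡) (here refl) =
      ∷ʳ-level z≤n max≡ asc≡ z≤n z≤n z≤n
    moves-sound {flat} (last≡ , max≡ , asc≡) (there (here refl)) =
      ∷ʳ-peak (subst (_< 1) (sym last≡) (s≤s z≤n)) (subst (_≤ 1) (sym max≡) z≤n) (cong suc asc≡)
    moves-sound {peak m d} (last≡ , max≡ , asc≡) (here refl) =
      ∷ʳ-level (subst (m ≤_) (sym last≡) (n≤1+n m)) max≡ asc≡ (n≤1+n m) ≤-refl (m≤2+m+d m d)
    moves-sound {peak m d} (last≡ , max≡ , asc≡) (there (here refl)) =
      ∷ʳ-level (≤-reflexive (sym last≡)) max≡ asc≡ ≤-refl (n≤1+n m) (s≤s (m≤n⇒m≤1+n (m≤m+n m d)))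
    moves-sound {peak m d} (last≡ , max≡ , asc≡) (there (there mem)) =
      ∷ʳ-ascent (≤-reflexive last≡) max≡ asc≡ mem
    moves-sound {dip m d} (last≡ , max≡ , asc≡) (here refl) =
      ∷ʳ-level (≤-reflexive (sym last≡)) max≡ asc≡ (n≤1+n m) ≤-refl (m≤2+m+d m d)
    moves-sound {dip m d} (last≡ , max≡ , asc≡) (there (here refl)) =
      ∷ʳ-peak (≤-reflexive (cong suc last≡)) (≤-reflexive max≡) (trans (cong suc asc≡) (sym (+-suc (suc m) d)))
    moves-sound {dip m d} (last≡ , max≡ , asc≡) (there (there mem)) =
      ∷ʳ-ascent (subst (_≤ suc m) (sym last≡) (n≤1+n m)) max≡ asc≡ mem

module Layers where

  open import Data.Nat
  open import Data.Nat.Properties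
  open import Data.Nat.ListAction using (sum)
  open import Data.Nat.ListAction.Properties using (sum-++)
  open import Data.List using (List; []; _∷_; map; _++_; _∷ʳ_; length; concatMap)
  open import Data.List.Properties using (map-∘; map-cong; map-++; map-concatMap; length-++; ∷ʳ-injectiveˡ; ∷ʳ-injectiveʳ)
  open import Data.List.Membership.Propositional using (_∈_; find; lose)
  open import Data.List.Membership.Propositional.Properties using (∈-map⁺; ∈-map⁻; ∈-concatMap⁺; ∈-concatMap⁻)
  open import Data.List.Relation.Unary.Any using (here)
  import Data.List.Relation.Unary.All as All
  import Data.List.Relation.Unary.All.Properties as All
  open import Data.List.Relation.Unary.AllPairs as AllPairs using ([]; _∷_)
  import Data.List.Relation.Unary.AllPairs.Properties as AllPairs
  open import Data.List.Relation.Unary.Linked using (Linked; []; [-]; _∷_)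
  open import Data.List.Relation.Unary.Linked.Properties using (Linked⇒AllPairs)
  open import Data.List.Relation.Unary.Unique.Propositional using (Unique)
  import Data.List.Relation.Unary.Unique.Propositional.Properties as Unique
  open import Data.List.Relation.Binary.Disjoint.Propositional using (Disjoint)
  open import Data.Product using (Σ; ∃; _×_; _,_; proj₁; proj₂; map₁)
  open import Function.Bundles using (_⇔_; mk⇔)
  open import Function using (_∘_)
  open import Relation.Binary.PropositionalEquality
  open Completions
  open SequenceShapes

  extend : List ℕ × Shape → List (List ℕ × Shape)
  extend (xs , σ) = map (map₁ (xs ∷ʳ_)) (moves σ)

  layer : ℕ → List (List ℕ × Shape)
  layer zero = ((0 ∷ []) , flat) ∷ []
  layer (suc n) = concatMap extend (layer n)

  length-∷ʳ : ∀ (xs : List ℕ) x → length (xs ∷ʳ x) ≡ suc (length xs)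
  length-∷ʳ xs x = trans (length-++ xs) (+-comm (length xs) 1)

  layer-sound : ∀ n {xs σ} → (xs , σ) ∈ layer n → RAS xs × length xs ≡ suc n × HasShape xs σ
  layer-sound zero (here refl) = ras-one , refl , refl , refl , refl
  layer-sound (suc n) mem
    with (ys , σ₀) , p∈layer , xs∈ext ← find (∈-concatMap⁻ extend mem)
    with (x , σ) , move , refl ← ∈-map⁻ (map₁ (ys ∷ʳ_)) xs∈ext
    with layer-sound n p∈layer
  ... | ras-ys , len , shape with ys
  ... | y ∷ ys′ with shape′ , lo , hi ← moves-sound y ys′ shape move =
    ras-snoc x ras-ys lo hi , trans (length-∷ʳ (y ∷ ys′) x) (cong suc len) , shape′

  layer-complete : ∀ {xs} → RAS xs → ∀ n → length xs ≡ suc n → Σ Shape λ σ → (xs , σ) ∈ layer n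
  layer-complete ras-one zero refl = flat , here refl
  layer-complete (ras-snoc {y} {ys} x ras-ys lo hi) n len
    with σ₀ , p∈layer ← layer-complete ras-ys (length ys) refl
    with _ , _ , shape ← layer-sound (length ys) p∈layer
    with σ , move ← moves-complete shape (lo , hi)
    with refl ← suc-injective (trans (sym (length-∷ʳ (y ∷ ys) x)) len) =
    σ , ∈-concatMap⁺ extend (lose p∈layer (∈-map⁺ (map₁ ((y ∷ ys) ∷ʳ_)) move))

  sum-map-concatMap : ∀ {A B : Set} (g : B → ℕ) (f : A → List B) xs →
                      sum (map g (concatMap f xs)) ≡ sum (map (sum ∘ map g ∘ f) xs)
  sum-map-concatMap g f [] = refl
  sum-map-concatMap g f (x ∷ xs) = begin
    sum (map g (f x ++ concatMap f xs))
      ≡⟨ cong sum (map-++ g (f x) (concatMap f xs)) ⟩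
    sum (map g (f x) ++ map g (concatMap f xs))
      ≡⟨ sum-++ (map g (f x)) _ ⟩
    sum (map g (f x)) + sum (map g (concatMap f xs))
      ≡⟨ cong (sum (map g (f x)) +_) (sum-map-concatMap g f xs) ⟩
    sum (map g (f x)) + sum (map (sum ∘ map g ∘ f) xs)
      ∎
    where open ≡-Reasoning

  extend-weight : ∀ m p → sum (map (completions m ∘ proj₂) (extend p)) ≡ completions (suc m) (proj₂ p)
  extend-weight m (xs , σ) = cong sum (sym (map-∘ (moves σ)))

  layer-weight : ∀ n m → sum (map (completions m ∘ proj₂) (layer n)) ≡ completions (n + m) flat
  layer-weight zero m = +-identityʳ (completions m flat)
  layer-weight (suc n) m = begin
    sum (map (completions m ∘ proj₂) (concatMap extend (layer n)))
      ≡⟨ sum-map-concatMap (completions m ∘ proj₂) extend (layer n) ⟩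
    sum (map (sum ∘ map (completions m ∘ proj₂) ∘ extend) (layer n))
      ≡⟨ cong sum (map-cong (extend-weight m) (layer n)) ⟩
    sum (map (completions (suc m) ∘ proj₂) (layer n))
      ≡⟨ layer-weight n (suc m) ⟩
    completions (n + suc m) flat
      ≡⟨ cong (λ k → completions k flat) (+-suc n m) ⟩
    completions (suc n + m) flat
      ∎
    where open ≡-Reasoning

  length≡sum-map-1 : ∀ {A : Set} (xs : List A) → length xs ≡ sum (map (λ _ → 1) xs)
  length≡sum-map-1 [] = refl
  length≡sum-map-1 (x ∷ xs) = cong suc (length≡sum-map-1 xs)

  length-layer : ∀ n → length (layer n) ≡ completions n flat
  length-layer n = begin
    length (layer n)
      ≡⟨ length≡sum-map-1 (layer n) ⟩
    sum (map (completions 0 ∘ proj₂) (layer n))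
      ≡⟨ layer-weight n 0 ⟩
    completions (n + 0) flat
      ≡⟨ cong (λ k → completions k flat) (+-identityʳ n) ⟩
    completions n flat
      ∎
    where open ≡-Reasoning

  ascents-increasing : ∀ x r → Linked _<_ (x ∷ map proj₁ (ascents x r))
  ascents-increasing x zero = [-]
  ascents-increasing x (suc r) = ≤-refl ∷ ascents-increasing (suc x) r

  moves-increasing : ∀ σ → Linked _<_ (map proj₁ (moves σ))
  moves-increasing flat = s≤s z≤n ∷ [-]
  moves-increasing (peak m d) = ≤-refl ∷ ascents-increasing (suc m) (suc d)
  moves-increasing (dip m d) = ≤-refl ∷ ascents-increasing (suc m) (suc d)

  moves-unique : ∀ σ → Unique (map proj₁ (moves σ))
  moves-unique σ = AllPairs.map <⇒≢ (Linked⇒AllPairs <-trans (moves-increasing σ))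

  extend-proj₁ : ∀ xs σ → map proj₁ (extend (xs , σ)) ≡ map (xs ∷ʳ_) (map proj₁ (moves σ))
  extend-proj₁ xs σ = trans (sym (map-∘ (moves σ))) (map-∘ (moves σ))

  extend-unique : ∀ p → Unique (map proj₁ (extend p))
  extend-unique (xs , σ) =
    subst Unique (sym (extend-proj₁ xs σ)) (Unique.map⁺ (∷ʳ-injectiveʳ xs xs) (moves-unique σ))

  ∈-extend⁻ : ∀ {v xs σ} → v ∈ map proj₁ (extend (xs , σ)) → ∃ λ x → v ≡ xs ∷ʳ x
  ∈-extend⁻ {xs = xs} {σ} mem with x , _ , v≡ ← ∈-map⁻ (xs ∷ʳ_) (subst (_ ∈_) (extend-proj₁ xs σ) mem) = x , v≡

  extend-disjoint : ∀ p q → proj₁ p ≢ proj₁ q → Disjoint (map proj₁ (extend p)) (map proj₁ (extend q))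
  extend-disjoint (xs , _) (ys , _) xs≢ys (v∈p , v∈q)
    with x , refl ← ∈-extend⁻ v∈p
    with y , v≡ ← ∈-extend⁻ v∈q = xs≢ys (∷ʳ-injectiveˡ xs ys v≡)

  layer-unique : ∀ n → Unique (map proj₁ (layer n))
  layer-unique zero = All.[] ∷ []
  layer-unique (suc n) = subst Unique (sym (map-concatMap proj₁ extend (layer n)))
    (Unique.concat⁺ (All.map⁺ (All.universal extend-unique (layer n)))
                    (AllPairs.map⁺ (AllPairs.map (extend-disjoint _ _) (AllPairs.map⁻ (layer-unique n)))))

  ∈-layer⇔RAS : ∀ n xs → xs ∈ map proj₁ (layer n) ⇔ (RAS xs × length xs ≡ suc n)
  ∈-layer⇔RAS n xs = mk⇔ sound complete
    where
    sound : xs ∈ map proj₁ (layer n) → RAS xs × length xs ≡ suc n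
    sound mem with (_ , σ) , p∈layer , refl ← ∈-map⁻ proj₁ mem
      with ras , len , _ ← layer-sound n p∈layer = ras , len
    complete : RAS xs × length xs ≡ suc n → xs ∈ map proj₁ (layer n)
    complete (ras , len) with σ , p∈layer ← layer-complete ras n len = ∈-map⁺ proj₁ p∈layer

open BallotNumbers using (ballot≡catalan)
open Completions using (flat≡ballot)
open Layers

∈-[[]]⇔RAS : ∀ xs → xs ∈ ([] ∷ []) ⇔ (RAS xs × length xs ≡ 0)
∈-[[]]⇔RAS xs = mk⇔ (λ { (here refl) → ras-nil , refl }) (λ { (ras-nil , _) → here refl })

theorem10 : (n : ℕ) → NumRAS n (catalan n)
theorem10 zero = ([] ∷ []) , ([] ∷ []) , refl , ∈-[[]]⇔RAS
theorem10 (suc n) = map proj₁ (layer n) , layer-unique n , count , ∈-layer⇔RAS n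
  where
  count : length (map proj₁ (layer n)) ≡ catalan (suc n)
  count = trans (length-map proj₁ (layer n))
         (trans (length-layer n) (trans (flat≡ballot n) (ballot≡catalan n)))
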